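{- If $M(A)$ and $N(B)$ are matched, then the free splice $M\mathbin{\Join} N$ is the intersection of the matroids $M|(A-B)\mathbin{\Join} N$ and $M\mathbin{\Join} N.(B-A)$ (both free products, i.e. free splices of matroids on disjoint ground sets); that is, the independent sets of $M\mathbin{\Join} N$ are exactly the sets independent in both of these matroids.
   Context: $K|X$ is restriction; $K.X$ is contraction of $K$ to $X$, i.e. $K/(E-X)$. $M(A)$, $N(B)$ matched means $M.(A\cap B)=N|(A\cap B)$ (any pair on disjoint sets is matched). Free splice $M\mathbin{\Join} N$ of matched $M(A)$, $N(B)$: matroid on $A\cup B$ with rank $r(X)=\min\{r_M(X\cap A)+|X-A|,\ r_N(X\cap B)+r_M(A-B)\}$; when $A\cap B=\emptyset$ this is the free product. -}

module Defs where

open import Data.Nat using (ℕ; _+_; _∸_; _≤_; _⊓_)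
open import Data.Fin.Subset using (Subset; _⊆_; _∩_; _∪_; _─_; ∣_∣)
open import Data.Product using (_×_)
open import Relation.Binary.PropositionalEquality using (_≡_)

-- A (raw) matroid on a ground set A ⊆ Fin n, given by its rank function.
-- The rank function is only meaningful on subsets of the ground set.
record RawMatroid (n : ℕ) : Set where
  constructor mkMatroid
  field
    ground : Subset n
    rank   : Subset n → ℕ
open RawMatroid public

record IsMatroid {n : ℕ} (M : RawMatroid n) : Set where
  field
    rank-≤-card : ∀ X → X ⊆ ground M → rank M X ≤ ∣ X ∣
    rank-mono   : ∀ X Y → Y ⊆ ground M → X ⊆ Y → rank M X ≤ rank M Y
    rank-submod : ∀ X Y → X ⊆ ground M → Y ⊆ ground M →
                  rank M (X ∪ Y) + rank M (X ∩ Y) ≤ rank M X + rank M Y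

restrict : ∀ {n} → RawMatroid n → Subset n → RawMatroid n
restrict M X = mkMatroid X (λ Y → rank M (Y ∩ X))

-- Contraction M.X = M/(E - X) (X ⊆ E = ground M):
-- rank Y = r_M((Y ∩ X) ∪ (E - X)) - r_M(E - X).
contract : ∀ {n} → RawMatroid n → Subset n → RawMatroid n
contract M X = mkMatroid X
  (λ Y → rank M ((Y ∩ X) ∪ (ground M ─ X)) ∸ rank M (ground M ─ X))

Matched : ∀ {n} → RawMatroid n → RawMatroid n → Set
Matched M N = ∀ Y → Y ⊆ (ground M ∩ ground N) →
  rank (contract M (ground M ∩ ground N)) Y ≡ rank (restrict N (ground M ∩ ground N)) Y

freeSplice : ∀ {n} → RawMatroid n → RawMatroid n → RawMatroid n
freeSplice M N = mkMatroid (ground M ∪ ground N)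
  (λ X → (rank M (X ∩ ground M) + ∣ X ─ ground M ∣)
       ⊓ (rank N (X ∩ ground N) + rank M (ground M ─ ground N)))

Indep : ∀ {n} → RawMatroid n → Subset n → Set
Indep M X = X ⊆ ground M × rank M X ≡ ∣ X ∣

-- The free splice rank is the minimum of  r_M(X ∩ A) + |X - A|  and  r_N(X ∩ B) + r_M(A - B),
-- and the first term never exceeds |X|. So X is independent exactly when X ∩ A is
-- M-independent and |X| is at most the second term. The two free products have the same
-- first condition up to restricting X ∩ A to A - B (harmless by heredity), and their second
-- terms compare with that of M ⋈ N as follows: for M|(A - B) ⋈ N it is literally the same,
-- while for M ⋈ N.(B - A) it is r_{N.(B-A)}(X - A) + r_M(A), which by matchedness equals
-- r_{N.(B-A)}(X - A) + r_N(A ∩ B) + r_M(A - B) ≥ r_N(X ∩ B) + r_M(A - B).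
module Submission where

open import Defs
open import Data.Bool.Base using (true; false)
open import Data.Nat.Base using (ℕ; suc; _+_; _∸_; _≤_; _⊓_)
open import Data.Nat.Properties
  using (≤-antisym; ≤-trans; m⊓n≤m; m⊓n≤n; m≤n⇒m⊓n≡m; m≤m+n; +-suc;
         +-monoˡ-≤; +-monoʳ-≤; +-cancelʳ-≤; +-cancelʳ-≡; +-assoc; m∸n+n≡m; module ≤-Reasoning)
open import Data.Fin.Subset using (Subset; _⊆_; _∩_; _∪_; _─_; ∣_∣)
open import Data.Fin.Subset.Properties
  using (⊆-refl; ⊆-trans; p∩q⊆p; p∩q⊆q; p─q⊆p; p⊆p∪q; q⊆p∪q; x∈p∪q⁻; x∈p∩q⁺; x∈p∩q⁻;
         x∈p∧x∉q⇒x∈p─q; _∈?_; ∣p∩q∣≤∣p∣; ∩-assoc; ∩-idem; ∪-comm; p─q─q≡p─q)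
open import Data.Product using (_×_; _,_)
open import Data.Sum using ([_,_])
open import Data.Vec.Base using ([]; _∷_)
open import Function.Bundles using (_⇔_; mk⇔; Equivalence)
open import Relation.Binary.PropositionalEquality using (_≡_; refl; sym; trans; cong; cong₂; subst; module ≡-Reasoning)
open import Relation.Nullary using (yes; no)

private
  variable
    n : ℕ

p─q∪q≡p∪q : (p q : Subset n) → (p ─ q) ∪ q ≡ p ∪ q
p─q∪q≡p∪q []          []          = refl
p─q∪q≡p∪q (true ∷ p)  (true ∷ q)  = cong (_ ∷_) (p─q∪q≡p∪q p q)
p─q∪q≡p∪q (true ∷ p)  (false ∷ q) = cong (_ ∷_) (p─q∪q≡p∪q p q)
p─q∪q≡p∪q (false ∷ p) (true ∷ q)  = cong (_ ∷_) (p─q∪q≡p∪q p q)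
p─q∪q≡p∪q (false ∷ p) (false ∷ q) = cong (_ ∷_) (p─q∪q≡p∪q p q)

p∪[q─p]≡p∪q : (p q : Subset n) → p ∪ (q ─ p) ≡ p ∪ q
p∪[q─p]≡p∪q p q = trans (∪-comm p (q ─ p)) (trans (p─q∪q≡p∪q q p) (∪-comm q p))

p∩q∪p─q≡p : (p q : Subset n) → (p ∩ q) ∪ (p ─ q) ≡ p
p∩q∪p─q≡p []          []          = refl
p∩q∪p─q≡p (true ∷ p)  (true ∷ q)  = cong (_ ∷_) (p∩q∪p─q≡p p q)
p∩q∪p─q≡p (true ∷ p)  (false ∷ q) = cong (_ ∷_) (p∩q∪p─q≡p p q)
p∩q∪p─q≡p (false ∷ p) (true ∷ q)  = cong (_ ∷_) (p∩q∪p─q≡p p q)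
p∩q∪p─q≡p (false ∷ p) (false ∷ q) = cong (_ ∷_) (p∩q∪p─q≡p p q)

p─[q─p]≡p : (p q : Subset n) → p ─ (q ─ p) ≡ p
p─[q─p]≡p []          []          = refl
p─[q─p]≡p (true ∷ p)  (true ∷ q)  = cong (_ ∷_) (p─[q─p]≡p p q)
p─[q─p]≡p (true ∷ p)  (false ∷ q) = cong (_ ∷_) (p─[q─p]≡p p q)
p─[q─p]≡p (false ∷ p) (true ∷ q)  = cong (_ ∷_) (p─[q─p]≡p p q)
p─[q─p]≡p (false ∷ p) (false ∷ q) = cong (_ ∷_) (p─[q─p]≡p p q)

q─[q─p]≡p∩q : (p q : Subset n) → q ─ (q ─ p) ≡ p ∩ q
q─[q─p]≡p∩q []          []          = refl
q─[q─p]≡p∩q (true ∷ p)  (true ∷ q)  = cong (_ ∷_) (q─[q─p]≡p∩q p q)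
q─[q─p]≡p∩q (true ∷ p)  (false ∷ q) = cong (_ ∷_) (q─[q─p]≡p∩q p q)
q─[q─p]≡p∩q (false ∷ p) (true ∷ q)  = cong (_ ∷_) (q─[q─p]≡p∩q p q)
q─[q─p]≡p∩q (false ∷ p) (false ∷ q) = cong (_ ∷_) (q─[q─p]≡p∩q p q)

p─p∩q≡p─q : (p q : Subset n) → p ─ (p ∩ q) ≡ p ─ q
p─p∩q≡p─q []          []          = refl
p─p∩q≡p─q (true ∷ p)  (true ∷ q)  = cong (_ ∷_) (p─p∩q≡p─q p q)
p─p∩q≡p─q (true ∷ p)  (false ∷ q) = cong (_ ∷_) (p─p∩q≡p─q p q)
p─p∩q≡p─q (false ∷ p) (true ∷ q)  = cong (_ ∷_) (p─p∩q≡p─q p q)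
p─p∩q≡p─q (false ∷ p) (false ∷ q) = cong (_ ∷_) (p─p∩q≡p─q p q)

p∩[p─q]≡p─q : (p q : Subset n) → p ∩ (p ─ q) ≡ p ─ q
p∩[p─q]≡p─q []          []          = refl
p∩[p─q]≡p─q (true ∷ p)  (true ∷ q)  = cong (_ ∷_) (p∩[p─q]≡p─q p q)
p∩[p─q]≡p─q (true ∷ p)  (false ∷ q) = cong (_ ∷_) (p∩[p─q]≡p─q p q)
p∩[p─q]≡p─q (false ∷ p) (true ∷ q)  = cong (_ ∷_) (p∩[p─q]≡p─q p q)
p∩[p─q]≡p─q (false ∷ p) (false ∷ q) = cong (_ ∷_) (p∩[p─q]≡p─q p q)

p∩q∩q≡p∩q : (p q : Subset n) → (p ∩ q) ∩ q ≡ p ∩ q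
p∩q∩q≡p∩q p q = trans (∩-assoc p q q) (cong (p ∩_) (∩-idem q))

∣p∣≡∣p∩q∣+∣p─q∣ : (p q : Subset n) → ∣ p ∣ ≡ ∣ p ∩ q ∣ + ∣ p ─ q ∣
∣p∣≡∣p∩q∣+∣p─q∣ []          []          = refl
∣p∣≡∣p∩q∣+∣p─q∣ (true ∷ p)  (true ∷ q)  = cong suc (∣p∣≡∣p∩q∣+∣p─q∣ p q)
∣p∣≡∣p∩q∣+∣p─q∣ (true ∷ p)  (false ∷ q) =
  trans (cong suc (∣p∣≡∣p∩q∣+∣p─q∣ p q)) (sym (+-suc ∣ p ∩ q ∣ ∣ p ─ q ∣))
∣p∣≡∣p∩q∣+∣p─q∣ (false ∷ p) (true ∷ q)  = ∣p∣≡∣p∩q∣+∣p─q∣ p q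
∣p∣≡∣p∩q∣+∣p─q∣ (false ∷ p) (false ∷ q) = ∣p∣≡∣p∩q∣+∣p─q∣ p q

∪-lub : {p q r : Subset n} → p ⊆ r → q ⊆ r → p ∪ q ⊆ r
∪-lub {p = p} {q} p⊆r q⊆r x∈p∪q = [ p⊆r , q⊆r ] (x∈p∪q⁻ p q x∈p∪q)

p∩q⊆p∩r∪q─r : (p q r : Subset n) → p ∩ q ⊆ (p ∩ r) ∪ (q ─ r)
p∩q⊆p∩r∪q─r p q r {x} x∈p∩q with x∈p∩q⁻ p q x∈p∩q | x ∈? r
... | x∈p , _   | yes x∈r = p⊆p∪q (q ─ r) (x∈p∩q⁺ (x∈p , x∈r))
... | _   , x∈q | no  x∉r = q⊆p∪q (p ∩ r) (q ─ r) (x∈p∧x∉q⇒x∈p─q x∈q x∉r)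

m⊓n≡o⇔m≡o×o≤n : {m n o : ℕ} → m ≤ o → m ⊓ n ≡ o ⇔ (m ≡ o × o ≤ n)
m⊓n≡o⇔m≡o×o≤n {m} {n} m≤o = mk⇔
  (λ m⊓n≡o → ≤-antisym m≤o (subst (_≤ m) m⊓n≡o (m⊓n≤m m n)) , subst (_≤ n) m⊓n≡o (m⊓n≤n m n))
  (λ { (refl , o≤n) → m≤n⇒m⊓n≡m o≤n })

RankBounded : RawMatroid n → Set
RankBounded M = ∀ Y → Y ⊆ ground M → rank M Y ≤ ∣ Y ∣

spliceBound : RawMatroid n → RawMatroid n → Subset n → ℕ
spliceBound M N X = rank N (X ∩ ground N) + rank M (ground M ─ ground N)

SpliceIndep : RawMatroid n → RawMatroid n → Subset n → Set
SpliceIndep M N X =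
  X ⊆ ground M ∪ ground N × Indep M (X ∩ ground M) × ∣ X ∣ ≤ spliceBound M N X

Indep-freeSplice⇔ : (M N : RawMatroid n) → RankBounded M →
                    ∀ X → Indep (freeSplice M N) X ⇔ SpliceIndep M N X
Indep-freeSplice⇔ M N rank≤card X = mk⇔
  (λ { (X⊆ , r≡∣X∣) → let (first≡∣X∣ , ∣X∣≤bound) = Equivalence.to min⇔ r≡∣X∣
                      in X⊆ , (p∩q⊆q X A , Equivalence.to first⇔ first≡∣X∣) , ∣X∣≤bound })
  (λ { (X⊆ , (_ , r≡∣X∩A∣) , ∣X∣≤bound) →
       X⊆ , Equivalence.from min⇔ (Equivalence.from first⇔ r≡∣X∩A∣ , ∣X∣≤bound) })
  where
  A = ground M
  first = rank M (X ∩ A) + ∣ X ─ A ∣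

  split : ∣ X ∣ ≡ ∣ X ∩ A ∣ + ∣ X ─ A ∣
  split = ∣p∣≡∣p∩q∣+∣p─q∣ X A

  first≤∣X∣ : first ≤ ∣ X ∣
  first≤∣X∣ = subst (first ≤_) (sym split) (+-monoˡ-≤ ∣ X ─ A ∣ (rank≤card (X ∩ A) (p∩q⊆q X A)))

  min⇔ : first ⊓ spliceBound M N X ≡ ∣ X ∣ ⇔ (first ≡ ∣ X ∣ × ∣ X ∣ ≤ spliceBound M N X)
  min⇔ = m⊓n≡o⇔m≡o×o≤n first≤∣X∣

  first⇔ : first ≡ ∣ X ∣ ⇔ rank M (X ∩ A) ≡ ∣ X ∩ A ∣
  first⇔ = mk⇔ (λ e → +-cancelʳ-≡ ∣ X ─ A ∣ _ _ (trans e split))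
               (λ e → trans (cong (_+ ∣ X ─ A ∣) e) (sym split))

module _ {M : RawMatroid n} (isM : IsMatroid M) where
  open IsMatroid isM

  rank≤rank-∩+∣─∣ : ∀ Z W → Z ⊆ ground M → rank M Z ≤ rank M (Z ∩ W) + ∣ Z ─ W ∣
  rank≤rank-∩+∣─∣ Z W Z⊆E = begin
    rank M Z                                         ≡⟨ cong (rank M) (p∩q∪p─q≡p Z W) ⟨
    rank M ((Z ∩ W) ∪ (Z ─ W))                       ≤⟨ m≤m+n _ _ ⟩
    rank M ((Z ∩ W) ∪ (Z ─ W)) + rank M ((Z ∩ W) ∩ (Z ─ W))
                                                     ≤⟨ rank-submod (Z ∩ W) (Z ─ W) Z∩W⊆E Z─W⊆E ⟩
    rank M (Z ∩ W) + rank M (Z ─ W)                  ≤⟨ +-monoʳ-≤ _ (rank-≤-card (Z ─ W) Z─W⊆E) ⟩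
    rank M (Z ∩ W) + ∣ Z ─ W ∣                       ∎
    where
    open ≤-Reasoning
    Z∩W⊆E : Z ∩ W ⊆ ground M
    Z∩W⊆E = ⊆-trans (p∩q⊆p Z W) Z⊆E
    Z─W⊆E : Z ─ W ⊆ ground M
    Z─W⊆E = ⊆-trans (p─q⊆p Z W) Z⊆E

  Indep-∩ : ∀ {Z} W → Indep M Z → Indep M (Z ∩ W)
  Indep-∩ {Z} W (Z⊆E , rZ≡∣Z∣) =
    ⊆-trans (p∩q⊆p Z W) Z⊆E ,
    ≤-antisym (rank-≤-card (Z ∩ W) (⊆-trans (p∩q⊆p Z W) Z⊆E))
      (+-cancelʳ-≤ ∣ Z ─ W ∣ _ _
        (subst (_≤ rank M (Z ∩ W) + ∣ Z ─ W ∣) (trans rZ≡∣Z∣ (∣p∣≡∣p∩q∣+∣p─q∣ Z W))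
          (rank≤rank-∩+∣─∣ Z W Z⊆E)))

  Indep-restrict : ∀ {Z} C → Indep M Z → Indep (restrict M C) (Z ∩ C)
  Indep-restrict {Z} C indZ with Indep-∩ C indZ
  ... | _ , r≡∣Z∩C∣ = p∩q⊆q Z C , trans (cong (rank M) (p∩q∩q≡p∩q Z C)) r≡∣Z∩C∣

  restrict-rankBounded : ∀ C → C ⊆ ground M → RankBounded (restrict M C)
  restrict-rankBounded C C⊆E Y _ =
    ≤-trans (rank-≤-card (Y ∩ C) (⊆-trans (p∩q⊆q Y C) C⊆E)) (∣p∩q∣≤∣p∣ Y C)

  rank≤contract-rank+rank-complement : ∀ {C} X → C ⊆ ground M →
    rank M (X ∩ ground M) ≤ rank (contract M C) (X ∩ C) + rank M (ground M ─ C)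
  rank≤contract-rank+rank-complement {C} X C⊆E = begin
    rank M (X ∩ E)                                    ≤⟨ rank-mono _ _ Z⊆E (p∩q⊆p∩r∪q─r X E C) ⟩
    rank M Z                                          ≡⟨ m∸n+n≡m (rank-mono _ _ Z⊆E (q⊆p∪q _ _)) ⟨
    rank M Z ∸ rank M (E ─ C) + rank M (E ─ C)        ≡⟨ cong (λ Y → rank M (Y ∪ (E ─ C)) ∸ rank M (E ─ C) + rank M (E ─ C))
                                                              (p∩q∩q≡p∩q X C) ⟨
    rank (contract M C) (X ∩ C) + rank M (E ─ C)      ∎
    where
    open ≤-Reasoning
    E = ground M
    Z = (X ∩ C) ∪ (E ─ C)
    Z⊆E : Z ⊆ E
    Z⊆E = ∪-lub (⊆-trans (p∩q⊆q X C) C⊆E) (p─q⊆p E C)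

-- r_{M.(A ∩ B)}(A ∩ B) = r_M(A) - r_M(A - B), as A - (A ∩ B) = A - B is what gets contracted.
Matched⇒rank-ground : {M N : RawMatroid n} → IsMatroid M → Matched M N →
  rank M (ground M) ≡ rank N (ground M ∩ ground N) + rank M (ground M ─ ground N)
Matched⇒rank-ground {M = M} {N} isM match = begin
  rank M A                                        ≡⟨ m∸n+n≡m (IsMatroid.rank-mono isM _ _ ⊆-refl (p─q⊆p A B)) ⟨
  rank M A ∸ rank M (A ─ B) + rank M (A ─ B)      ≡⟨ cong (_+ rank M (A ─ B)) contracted ⟩
  rank N (A ∩ B) + rank M (A ─ B)                 ∎
  where
  open ≡-Reasoning
  A = ground M
  B = ground N

  contracted : rank M A ∸ rank M (A ─ B) ≡ rank N (A ∩ B)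
  contracted = begin
    rank M A ∸ rank M (A ─ B)                     ≡⟨ cong₂ (λ Y Z → rank M Y ∸ rank M Z)
                                                       (trans (cong₂ _∪_ (∩-idem (A ∩ B)) (p─p∩q≡p─q A B))
                                                              (p∩q∪p─q≡p A B))
                                                       (p─p∩q≡p─q A B) ⟨
    rank (contract M (A ∩ B)) (A ∩ B)             ≡⟨ match (A ∩ B) ⊆-refl ⟩
    rank N ((A ∩ B) ∩ (A ∩ B))                    ≡⟨ cong (rank N) (∩-idem (A ∩ B)) ⟩
    rank N (A ∩ B)                                ∎

spliceBound-restrict : (M N : RawMatroid n) (X : Subset n) →
  spliceBound (restrict M (ground M ─ ground N)) N X ≡ spliceBound M N X
spliceBound-restrict M N X =
  cong (λ Y → rank N (X ∩ B) + rank M Y) (trans (cong (_∩ (A ─ B)) (p─q─q≡p─q A B)) (∩-idem (A ─ B)))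
  where
  A = ground M
  B = ground N

spliceBound-≤-contract : {M N : RawMatroid n} → IsMatroid M → IsMatroid N → Matched M N →
  ∀ X → spliceBound M N X ≤ spliceBound M (contract N (ground N ─ ground M)) X
spliceBound-≤-contract {M = M} {N} isM isN match X = begin
  rank N (X ∩ B) + rank M (A ─ B)                 ≤⟨ +-monoˡ-≤ _ (rank≤contract-rank+rank-complement isN X (p─q⊆p B A)) ⟩
  rC + rank N (B ─ (B ─ A)) + rank M (A ─ B)      ≡⟨ cong (λ Y → rC + rank N Y + rank M (A ─ B)) (q─[q─p]≡p∩q A B) ⟩
  rC + rank N (A ∩ B) + rank M (A ─ B)            ≡⟨ +-assoc rC _ _ ⟩
  rC + (rank N (A ∩ B) + rank M (A ─ B))          ≡⟨ cong (rC +_) (Matched⇒rank-ground {N = N} isM match) ⟨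
  rC + rank M A                                   ≡⟨ cong (λ Y → rC + rank M Y) (p─[q─p]≡p A B) ⟨
  rC + rank M (A ─ (B ─ A))                       ∎
  where
  open ≤-Reasoning
  A = ground M
  B = ground N
  rC = rank (contract N (B ─ A)) (X ∩ (B ─ A))

proposition5p7 : {n : ℕ} (M N : RawMatroid n) →
    IsMatroid M → IsMatroid N → Matched M N →
    (X : Subset n) →
    Indep (freeSplice M N) X ⇔
      (Indep (freeSplice (restrict M (ground M ─ ground N)) N) X
       × Indep (freeSplice M (contract N (ground N ─ ground M))) X)
proposition5p7 M N isM isN match X = mk⇔
  (λ indX → let (X⊆ , indX∩A , ∣X∣≤bound) = Equivalence.to splice indX in
     Equivalence.from splice₁
       ( subst (X ⊆_) (sym (p─q∪q≡p∪q A B)) X⊆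
       , subst (Indep M₁) (X∩A∩[A─B]≡X∩[A─B])
           (Indep-restrict isM (A ─ B) indX∩A)
       , subst (∣ X ∣ ≤_) (sym (spliceBound-restrict M N X)) ∣X∣≤bound )
   , Equivalence.from splice₂
       ( subst (X ⊆_) (sym (p∪[q─p]≡p∪q A B)) X⊆
       , indX∩A
       , ≤-trans ∣X∣≤bound (spliceBound-≤-contract isM isN match X) ))
  (λ (indX₁ , indX₂) →
     let (X⊆ , _ , ∣X∣≤bound) = Equivalence.to splice₁ indX₁
         (_ , indX∩A , _)     = Equivalence.to splice₂ indX₂
     in Equivalence.from splice
          (subst (X ⊆_) (p─q∪q≡p∪q A B) X⊆ , indX∩A , subst (∣ X ∣ ≤_) (spliceBound-restrict M N X) ∣X∣≤bound))
  where
  A = ground M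
  B = ground N
  M₁ = restrict M (A ─ B)
  N₂ = contract N (B ─ A)

  splice : Indep (freeSplice M N) X ⇔ SpliceIndep M N X
  splice = Indep-freeSplice⇔ M N (IsMatroid.rank-≤-card isM) X

  splice₁ : Indep (freeSplice M₁ N) X ⇔ SpliceIndep M₁ N X
  splice₁ = Indep-freeSplice⇔ M₁ N (restrict-rankBounded isM (A ─ B) (p─q⊆p A B)) X

  splice₂ : Indep (freeSplice M N₂) X ⇔ SpliceIndep M N₂ X
  splice₂ = Indep-freeSplice⇔ M N₂ (IsMatroid.rank-≤-card isM) X

  X∩A∩[A─B]≡X∩[A─B] : (X ∩ A) ∩ (A ─ B) ≡ X ∩ (A ─ B)
  X∩A∩[A─B]≡X∩[A─B] = trans (∩-assoc X A (A ─ B)) (cong (X ∩_) (p∩[p─q]≡p─q A B))
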